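{- Let $k\ge 2$. For any input $L$ of bin packing with cardinality constraint $k$, the algorithm Thin and Fat satisfies $TF(L)\le 2\cdot OPT(L)$.
   Context: Bin packing with cardinality constraints (BPCC): there is a global integer parameter $k\ge 2$; the input is a sequence of items with sizes $s_i\in(0,1]$. Items must be partitioned into bins so that each bin has total size (level) $s(B)\le 1$ and contains at most $k$ items; the goal is to minimize the number of bins. $OPT(L)$ is the minimum number of bins for input $L$, and $TF(L)$ is the number of bins used by the following online algorithm Thin and Fat (TF). TF maintains three kinds of bins: paired bins (bins grouped into matched pairs, never used again), fat bins (bins with exactly $k-1$ items, not paired), and thin bins (nonempty, unpaired bins with at most $k-2$ items); initially there are none. When a new item $i$ arrives, the following steps are tried in order until $i$ is packed: (1) If there is a fat bin $B$ with $s(B)+s_i>1$, pack $i$ into a new bin, match $B$ with the new bin, and these two bins become paired. (2) If there are no thin bins, pack $i$ into a new bin. (3) If there is a thin bin $B$ with $s(B)+s_i\le1$, pack $i$ into $B$; if $B$ thereby becomes fat and there is a thin bin $B'\neq B$, match $B$ and $B'$, and they become paired. (4) If there are no fat bins, pack $i$ into a new bin. (5) Pack $i$ into a fat bin $B$, and match $B$ with a thin bin $B'$; these become paired.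
   Formalization: The item sizes $s_i$ are rational numbers in (0,1]. -}

module Defs where

open import Data.Nat as ℕ using (ℕ; suc; _∸_)
open import Data.Rational as ℚ using (ℚ; 0ℚ; 1ℚ)
open import Data.List using (List; []; _∷_; _++_; length; foldr; concat; [_])
open import Data.List.Relation.Unary.All using (All)
open import Data.List.Relation.Binary.Permutation.Propositional using (_↭_)
open import Data.Product using (_×_; _,_)
open import Relation.Binary.PropositionalEquality using (_≡_; _≢_)

-- A bin is the list of the sizes of the items it contains.
Bin : Set
Bin = List ℚ

level : Bin → ℚ
level = foldr ℚ._+_ 0ℚ

ValidSize : ℚ → Set
ValidSize s = (0ℚ ℚ.< s) × (s ℚ.≤ 1ℚ)

ValidPacking : ℕ → List ℚ → List Bin → Set
ValidPacking k L P =
  (concat P ↭ L) × All (λ B → (length B ℕ.≤ k) × (level B ℚ.≤ 1ℚ)) P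

record TFState : Set where
  constructor st
  field
    paired : List (Bin × Bin)
    fat    : List Bin
    thin   : List Bin
open TFState public

initial : TFState
initial = st [] [] []

bins : TFState → ℕ
bins σ = 2 ℕ.* length (paired σ) ℕ.+ length (fat σ) ℕ.+ length (thin σ)

data AddNew (k : ℕ) (s : ℚ) : TFState → TFState → Set where
  newFat  : ∀ {p f t} → 1 ≡ k ∸ 1 → AddNew k s (st p f t) (st p ([ s ] ∷ f) t)
  newThin : ∀ {p f t} → 1 ≢ k ∸ 1 → AddNew k s (st p f t) (st p f ([ s ] ∷ t))

NoFatOverflow : List Bin → ℚ → Set
NoFatOverflow f s = All (λ B → level B ℚ.+ s ℚ.≤ 1ℚ) f

-- One step of TF on item s (nondeterministic in the choice of bins).
data Step (k : ℕ) (s : ℚ) : TFState → TFState → Set where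
  step1 : ∀ {p t xs B ys} → 1ℚ ℚ.< level B ℚ.+ s →
          Step k s (st p (xs ++ B ∷ ys) t) (st ((B , [ s ]) ∷ p) (xs ++ ys) t)
  step2 : ∀ {p f σ'} → NoFatOverflow f s → AddNew k s (st p f []) σ' →
          Step k s (st p f []) σ'
  step3-thin : ∀ {p f xs B ys} → NoFatOverflow f s → level B ℚ.+ s ℚ.≤ 1ℚ →
          length (s ∷ B) ℕ.< k ∸ 1 →
          Step k s (st p f (xs ++ B ∷ ys)) (st p f (xs ++ (s ∷ B) ∷ ys))
  step3-pair : ∀ {p f xs B ys us B' vs} → NoFatOverflow f s → level B ℚ.+ s ℚ.≤ 1ℚ →
          length (s ∷ B) ≡ k ∸ 1 → xs ++ ys ≡ us ++ B' ∷ vs →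
          Step k s (st p f (xs ++ B ∷ ys)) (st ((s ∷ B , B') ∷ p) f (us ++ vs))
  step3-fat : ∀ {p f xs B ys} → NoFatOverflow f s → level B ℚ.+ s ℚ.≤ 1ℚ →
          length (s ∷ B) ≡ k ∸ 1 → xs ++ ys ≡ [] →
          Step k s (st p f (xs ++ B ∷ ys)) (st p ((s ∷ B) ∷ f) [])
  step4 : ∀ {p t σ'} → t ≢ [] → All (λ B → 1ℚ ℚ.< level B ℚ.+ s) t →
          AddNew k s (st p [] t) σ' → Step k s (st p [] t) σ'
  step5 : ∀ {p xs B ys us B' vs} →
          NoFatOverflow (xs ++ B ∷ ys) s →
          All (λ C → 1ℚ ℚ.< level C ℚ.+ s) (us ++ B' ∷ vs) →
          Step k s (st p (xs ++ B ∷ ys) (us ++ B' ∷ vs))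
                   (st ((s ∷ B , B') ∷ p) (xs ++ ys) (us ++ vs))

data Run (k : ℕ) : TFState → List ℚ → TFState → Set where
  done : ∀ {σ} → Run k σ [] σ
  next : ∀ {σ σ' σ'' s L} → Step k s σ σ' → Run k σ' L σ'' → Run k σ (s ∷ L) σ''

module Submission where

-- Write k = 2 + j.  Two facts about every state σ reached by TF are proved:
--  * conservation: for any additive item weight (in any commutative monoid)
--    the bins of σ carry exactly the weight of the items read, so the
--    number of items and the total size in σ agree with those of any packing P
--    of L, hence are at most k·|P| and |P| respectively (WeightedSum);
--  * an invariant (Invariant): every matched pair holds ≥ k items and
--    overflows, fat bins hold k - 1 items, thin bins hold between 1 and k - 2
--    items, any two thin bins overflow together, and when a fat bin exists
--    there is at most one thin bin; each of the rules (1)-(5) preserves it.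
-- The bound then follows by counting (tf-bound): if #thin ≤ #fat the item
-- count gives it (count-bound); otherwise there is no fat bin, and as the thin
-- bins pairwise overflow the total size exceeds #pairs + ⌊#thin/2⌋ (size-bound).

open import Defs
open import Data.Nat using (ℕ; _≤_; _*_)
open import Data.List using (List; length)
open import Data.List.Relation.Unary.All using (All)
open import Data.Rational using (ℚ)

open import Data.Nat using (zero; suc; _+_; _<_; s≤s; z≤n; s≤s⁻¹; ⌊_/2⌋; _≤?_)
import Data.Nat.Properties as NP
open import Data.Nat.Solver using (module +-*-Solver)
import Data.Rational as Q
open Q using (0ℚ; 1ℚ)
import Data.Rational.Properties as QP
open import Function using (id; const; _∘_)

open import Algebra.Bundles using (CommutativeMonoid)
open import Data.List using ([]; _∷_; _++_; concat; foldr; [_])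
open import Data.List.Relation.Unary.All using ([]; _∷_)
import Data.List.Relation.Unary.All as All
import Data.List.Relation.Unary.All.Properties as AllP
open import Data.List.Relation.Unary.AllPairs using (AllPairs; []; _∷_)
import Data.List.Relation.Binary.Permutation.Propositional as Perm
open Perm using (_↭_)
open import Data.Product using (_×_; _,_; proj₁; proj₂)
open import Data.Sum using (_⊎_; inj₁; inj₂)
import Data.Sum as Sum
open import Relation.Binary.Core using (Rel; _Preserves₂_⟶_⟶_)
import Relation.Binary.PropositionalEquality as ≡
open ≡ using (_≡_; _≢_)
open import Relation.Nullary using (yes; no; contradiction)

module WeightedSum {c ℓ} (M : CommutativeMonoid c ℓ) where

  open CommutativeMonoid M
  open import Algebra.Properties.CommutativeSemigroup commutativeSemigroup using (x∙yz≈y∙xz)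
  open import Algebra.Solver.CommutativeMonoid M using (solve; _⊜_; _⊕_) renaming (id to e)
  open import Relation.Binary.Reasoning.Setoid setoid

  Σ⟨_⟩ : {A : Set} → (A → Carrier) → List A → Carrier
  Σ⟨ g ⟩ = foldr (λ x acc → g x ∙ acc) ε

  module _ {A : Set} (g : A → Carrier) where

    Σ-++ : (xs ys : List A) → Σ⟨ g ⟩ (xs ++ ys) ≈ Σ⟨ g ⟩ xs ∙ Σ⟨ g ⟩ ys
    Σ-++ []       ys = sym (identityˡ _)
    Σ-++ (x ∷ xs) ys = trans (∙-congˡ (Σ-++ xs ys)) (sym (assoc (g x) _ _))

    Σ-extract : (xs : List A) (y : A) (ys : List A) →
                Σ⟨ g ⟩ (xs ++ y ∷ ys) ≈ g y ∙ Σ⟨ g ⟩ (xs ++ ys)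
    Σ-extract []       y ys = refl
    Σ-extract (x ∷ xs) y ys =
      trans (∙-congˡ (Σ-extract xs y ys)) (x∙yz≈y∙xz (g x) (g y) _)

    Σ-↭ : {xs ys : List A} → xs ↭ ys → Σ⟨ g ⟩ xs ≈ Σ⟨ g ⟩ ys
    Σ-↭ Perm.refl         = refl
    Σ-↭ (Perm.prep x p)   = ∙-congˡ (Σ-↭ p)
    Σ-↭ (Perm.swap x y p) = trans (∙-congˡ (∙-congˡ (Σ-↭ p))) (x∙yz≈y∙xz (g x) (g y) _)
    Σ-↭ (Perm.trans p q)  = trans (Σ-↭ p) (Σ-↭ q)

    Σ-concat : (P : List (List A)) → Σ⟨ g ⟩ (concat P) ≈ Σ⟨ Σ⟨ g ⟩ ⟩ P
    Σ-concat []      = refl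
    Σ-concat (B ∷ P) = trans (Σ-++ B (concat P)) (∙-congˡ (Σ-concat P))

  Σ-mono : ∀ {r} {_≼_ : Rel Carrier r} → ε ≼ ε → _∙_ Preserves₂ _≼_ ⟶ _≼_ ⟶ _≼_ →
           {A : Set} {f g : A → Carrier} {xs : List A} →
           All (λ x → f x ≼ g x) xs → Σ⟨ f ⟩ xs ≼ Σ⟨ g ⟩ xs
  Σ-mono ε≼ε ∙-mono [] = ε≼ε
  Σ-mono {_≼_ = _≼_} ε≼ε ∙-mono (fx≼gx ∷ h) = ∙-mono fx≼gx (Σ-mono {_≼_ = _≼_} ε≼ε ∙-mono h)

  module _ (w : ℚ → Carrier) where

    pairWeight : Bin × Bin → Carrier
    pairWeight (B , C) = Σ⟨ w ⟩ B ∙ Σ⟨ w ⟩ C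

    private
      Wp : List (Bin × Bin) → Carrier
      Wp = Σ⟨ pairWeight ⟩
      Wb : List Bin → Carrier
      Wb = Σ⟨ Σ⟨ w ⟩ ⟩

    stateWeight : TFState → Carrier
    stateWeight σ = Wp (paired σ) ∙ (Wb (fat σ) ∙ Wb (thin σ))

    addNew-weight : ∀ {k s σ σ'} → AddNew k s σ σ' → stateWeight σ' ≈ w s ∙ stateWeight σ
    addNew-weight {s = s} (newFat {p} {f} {t} _) =
      solve 4 (λ s P F T → P ⊕ ((s ⊕ e) ⊕ F) ⊕ T ⊜ s ⊕ P ⊕ F ⊕ T) refl
        (w s) (Wp p) (Wb f) (Wb t)
    addNew-weight {s = s} (newThin {p} {f} {t} _) =
      solve 4 (λ s P F T → P ⊕ F ⊕ (s ⊕ e) ⊕ T ⊜ s ⊕ P ⊕ F ⊕ T) refl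
        (w s) (Wp p) (Wb f) (Wb t)

    state-cong : ∀ p f t {F T} → Wb f ≈ F → Wb t ≈ T → stateWeight (st p f t) ≈ Wp p ∙ (F ∙ T)
    state-cong p f t hf ht = ∙-congˡ (∙-cong hf ht)

    -- Every step of TF adds the weight of the new item: pull the bins touched by
    -- the step out of their lists (Σ-extract) and regroup.
    step-weight : ∀ {k s σ σ'} → Step k s σ σ' → stateWeight σ' ≈ w s ∙ stateWeight σ
    step-weight {s = s} (step1 {p = p} {t} {xs} {B} {ys} _) =
      trans (solve 5 (λ s b P F T → ((b ⊕ s ⊕ e) ⊕ P) ⊕ F ⊕ T ⊜ s ⊕ P ⊕ (b ⊕ F) ⊕ T) refl
               (w s) (Σ⟨ w ⟩ B) (Wp p) (Wb (xs ++ ys)) (Wb t))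
            (∙-congˡ (sym (state-cong p (xs ++ B ∷ ys) t (Σ-extract Σ⟨ w ⟩ xs B ys) refl)))
    step-weight (step2 _ new) = addNew-weight new
    step-weight {s = s} (step3-thin {p = p} {f} {xs} {B} {ys} _ _ _) =
      trans (state-cong p f (xs ++ (s ∷ B) ∷ ys) refl (Σ-extract Σ⟨ w ⟩ xs (s ∷ B) ys))
      (trans (solve 5 (λ s b P F T → P ⊕ F ⊕ (s ⊕ b) ⊕ T ⊜ s ⊕ P ⊕ F ⊕ b ⊕ T) refl
                (w s) (Σ⟨ w ⟩ B) (Wp p) (Wb f) (Wb (xs ++ ys)))
             (∙-congˡ (sym (state-cong p f (xs ++ B ∷ ys) refl (Σ-extract Σ⟨ w ⟩ xs B ys)))))
    step-weight {s = s} (step3-pair {p = p} {f} {xs} {B} {ys} {us} {B'} {vs} _ _ _ eq) =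
      trans (solve 6 (λ s b b' P F T → (((s ⊕ b) ⊕ b') ⊕ P) ⊕ F ⊕ T ⊜ s ⊕ P ⊕ F ⊕ b ⊕ b' ⊕ T) refl
               (w s) (Σ⟨ w ⟩ B) (Σ⟨ w ⟩ B') (Wp p) (Wb f) (Wb (us ++ vs)))
            (∙-congˡ (sym (state-cong p f (xs ++ B ∷ ys) refl
              (trans (Σ-extract Σ⟨ w ⟩ xs B ys)
                     (∙-congˡ (trans (reflexive (≡.cong Wb eq)) (Σ-extract Σ⟨ w ⟩ us B' vs)))))))
    step-weight {s = s} (step3-fat {p = p} {f} {xs} {B} {ys} _ _ _ eq) =
      trans (solve 4 (λ s b P F → P ⊕ ((s ⊕ b) ⊕ F) ⊕ e ⊜ s ⊕ P ⊕ F ⊕ b ⊕ e) refl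
               (w s) (Σ⟨ w ⟩ B) (Wp p) (Wb f))
            (∙-congˡ (sym (state-cong p f (xs ++ B ∷ ys) refl
              (trans (Σ-extract Σ⟨ w ⟩ xs B ys) (∙-congˡ (reflexive (≡.cong Wb eq)))))))
    step-weight (step4 _ _ new) = addNew-weight new
    step-weight {s = s} (step5 {p = p} {xs} {B} {ys} {us} {B'} {vs} _ _) =
      trans (solve 6 (λ s b b' P F T → (((s ⊕ b) ⊕ b') ⊕ P) ⊕ F ⊕ T ⊜ s ⊕ P ⊕ (b ⊕ F) ⊕ b' ⊕ T) refl
               (w s) (Σ⟨ w ⟩ B) (Σ⟨ w ⟩ B') (Wp p) (Wb (xs ++ ys)) (Wb (us ++ vs)))
            (∙-congˡ (sym (state-cong p (xs ++ B ∷ ys) (us ++ B' ∷ vs)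
              (Σ-extract Σ⟨ w ⟩ xs B ys) (Σ-extract Σ⟨ w ⟩ us B' vs))))

    run-weight : ∀ {k σ L σ'} → Run k σ L σ' → stateWeight σ' ≈ Σ⟨ w ⟩ L ∙ stateWeight σ
    run-weight done = sym (identityˡ _)
    run-weight {σ = σ} {σ' = σ''} (next {σ' = σ'} {s = s} {L = L} step run) = begin
      stateWeight σ''                            ≈⟨ run-weight run ⟩
      Σ⟨ w ⟩ L ∙ stateWeight σ'                  ≈⟨ ∙-congˡ (step-weight step) ⟩
      Σ⟨ w ⟩ L ∙ (w s ∙ stateWeight σ)           ≈⟨ x∙yz≈y∙xz _ _ _ ⟩
      w s ∙ (Σ⟨ w ⟩ L ∙ stateWeight σ)           ≈⟨ sym (assoc _ _ _) ⟩
      Σ⟨ w ⟩ (s ∷ L) ∙ stateWeight σ             ∎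

    tf-weight : ∀ {k L σ} (P : List Bin) → Run k initial L σ → concat P ↭ L →
                stateWeight σ ≈ Σ⟨ Σ⟨ w ⟩ ⟩ P
    tf-weight {L = L} {σ} P run P↭L = begin
      stateWeight σ                ≈⟨ run-weight run ⟩
      Σ⟨ w ⟩ L ∙ (ε ∙ (ε ∙ ε))     ≈⟨ ∙-congˡ (trans (identityˡ _) (identityˡ _)) ⟩
      Σ⟨ w ⟩ L ∙ ε                 ≈⟨ identityʳ _ ⟩
      Σ⟨ w ⟩ L                     ≈⟨ sym (Σ-↭ w P↭L) ⟩
      Σ⟨ w ⟩ (concat P)            ≈⟨ Σ-concat w P ⟩
      Σ⟨ Σ⟨ w ⟩ ⟩ P                ∎

module ℕΣ = WeightedSum NP.+-0-commutativeMonoid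
module ℚΣ = WeightedSum QP.+-0-commutativeMonoid

items : TFState → ℕ
items = ℕΣ.stateWeight (const 1)

size : TFState → ℚ
size = ℚΣ.stateWeight id

ℕΣ-const : ∀ {A : Set} c (xs : List A) → ℕΣ.Σ⟨ const c ⟩ xs ≡ c * length xs
ℕΣ-const c []       = ≡.sym (NP.*-zeroʳ c)
ℕΣ-const c (x ∷ xs) = ≡.trans (≡.cong (c +_) (ℕΣ-const c xs)) (≡.sym (NP.*-suc c (length xs)))

ℕΣ-mono : ∀ {A : Set} {f g : A → ℕ} {xs : List A} →
          All (λ x → f x ≤ g x) xs → ℕΣ.Σ⟨ f ⟩ xs ≤ ℕΣ.Σ⟨ g ⟩ xs
ℕΣ-mono = ℕΣ.Σ-mono {_≼_ = _≤_} z≤n NP.+-mono-≤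

ℚΣ-mono : ∀ {A : Set} {f g : A → ℚ} {xs : List A} →
          All (λ x → f x Q.≤ g x) xs → ℚΣ.Σ⟨ f ⟩ xs Q.≤ ℚΣ.Σ⟨ g ⟩ xs
ℚΣ-mono = ℚΣ.Σ-mono {_≼_ = Q._≤_} QP.≤-refl QP.+-mono-≤

fromℕ : ℕ → ℚ
fromℕ zero    = 0ℚ
fromℕ (suc n) = 1ℚ Q.+ fromℕ n

fromℕ-+ : ∀ m n → fromℕ (m + n) ≡ fromℕ m Q.+ fromℕ n
fromℕ-+ zero    n = ≡.sym (QP.+-identityˡ (fromℕ n))
fromℕ-+ (suc m) n = ≡.trans (≡.cong (1ℚ Q.+_) (fromℕ-+ m n)) (≡.sym (QP.+-assoc 1ℚ (fromℕ m) (fromℕ n)))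

fromℕ-mono : ∀ {m n} → m ≤ n → fromℕ m Q.≤ fromℕ n
fromℕ-mono {n = zero}  z≤n = QP.≤-refl
fromℕ-mono {n = suc n} z≤n = QP.+-mono-≤ (QP.<⇒≤ (QP.positive⁻¹ 1ℚ)) (fromℕ-mono {n = n} z≤n)
fromℕ-mono (s≤s m≤n)       = QP.+-monoʳ-≤ 1ℚ (fromℕ-mono m≤n)

fromℕ-cancel-< : ∀ m n → fromℕ m Q.< fromℕ n → m < n
fromℕ-cancel-< m n fm<fn with suc m ≤? n
... | yes m<n = m<n
... | no m≮n  = contradiction (QP.<-≤-trans fm<fn (fromℕ-mono (NP.≮⇒≥ m≮n))) (QP.<-irrefl ≡.refl)

ℚΣ-one : ∀ {A : Set} (xs : List A) → ℚΣ.Σ⟨ const 1ℚ ⟩ xs ≡ fromℕ (length xs)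
ℚΣ-one []       = ≡.refl
ℚΣ-one (x ∷ xs) = ≡.cong (1ℚ Q.+_) (ℚΣ-one xs)

module _ {A : Set} {P : A → Set} where

  All-extract : ∀ xs {y ys} → All P (xs ++ y ∷ ys) → P y × All P (xs ++ ys)
  All-extract xs h with AllP.++⁻ xs h
  ... | hxs , py ∷ hys = py , AllP.++⁺ hxs hys

  All-insert : ∀ xs {y ys} → P y → All P (xs ++ ys) → All P (xs ++ y ∷ ys)
  All-insert xs py h with AllP.++⁻ xs h
  ... | hxs , hys = AllP.++⁺ hxs (py ∷ hys)

module _ {A : Set} {R : A → A → Set} (R-sym : ∀ {x y} → R x y → R y x) where

  AllPairs-extract : ∀ xs {y ys} → AllPairs R (xs ++ y ∷ ys) →
                     All (R y) (xs ++ ys) × AllPairs R (xs ++ ys)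
  AllPairs-extract []       (ry ∷ r) = ry , r
  AllPairs-extract (x ∷ xs) (rx ∷ r) with All-extract xs rx | AllPairs-extract xs r
  ... | rxy , rx′ | ry , r′ = R-sym rxy ∷ ry , rx′ ∷ r′

  AllPairs-insert : ∀ xs {y ys} → All (R y) (xs ++ ys) → AllPairs R (xs ++ ys) →
                    AllPairs R (xs ++ y ∷ ys)
  AllPairs-insert []       ry        r        = ry ∷ r
  AllPairs-insert (x ∷ xs) (ryx ∷ ry) (rx ∷ r) =
    All-insert xs (R-sym ryx) rx ∷ AllPairs-insert xs ry r

length-extract : ∀ {A : Set} (xs : List A) {y ys} → length (xs ++ y ∷ ys) ≡ suc (length (xs ++ ys))
length-extract []       = ≡.refl
length-extract (x ∷ xs) = ≡.cong suc (length-extract xs)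

record Overfull (B C : Bin) : Set where
  constructor overfull
  field excess : 1ℚ Q.< level B Q.+ level C
open Overfull

overfull-sym : ∀ {B C} → Overfull B C → Overfull C B
overfull-sym {B} {C} (overfull ex) = overfull (≡.subst (1ℚ Q.<_) (QP.+-comm (level B) (level C)) ex)

overfull-mono : ∀ {B B₁ C} → level B Q.≤ level B₁ → Overfull B C → Overfull B₁ C
overfull-mono {C = C} B≤B₁ (overfull ex) = overfull (QP.<-≤-trans ex (QP.+-monoˡ-≤ (level C) B≤B₁))

level-single : ∀ s → level [ s ] ≡ s
level-single = QP.+-identityʳ

level-∷ : ∀ {s} B → 0ℚ Q.≤ s → level B Q.≤ level (s ∷ B)
level-∷ {s} B 0≤s = ≡.subst (Q._≤ s Q.+ level B) (QP.+-identityˡ (level B)) (QP.+-monoˡ-≤ (level B) 0≤s)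

overfull-single : ∀ {s C} → 1ℚ Q.< level C Q.+ s → Overfull C [ s ]
overfull-single {s} {C} ex = overfull (≡.subst (λ x → 1ℚ Q.< level C Q.+ x) (≡.sym (level-single s)) ex)

-- Nonnegative levels of fat bins are needed for rule (5).
PairedOK : ℕ → Bin × Bin → Set
PairedOK j (B , C) = 2 + j ≤ length B + length C × Overfull B C

FatOK : ℕ → Bin → Set
FatOK j B = length B ≡ suc j × 0ℚ Q.≤ level B

ThinOK : ℕ → Bin → Set
ThinOK j B = 1 ≤ length B × length B ≤ j × 0ℚ Q.< level B

record Invariant (j : ℕ) (σ : TFState) : Set where
  constructor invariant
  field
    paired-ok     : All (PairedOK j) (paired σ)
    fat-ok        : All (FatOK j) (fat σ)
    thin-ok       : All (ThinOK j) (thin σ)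
    thin-overfull : AllPairs Overfull (thin σ)
    few-thin      : fat σ ≡ [] ⊎ length (thin σ) ≤ 1
open Invariant

fat⇒few-thin : ∀ xs {B : Bin} {ys n} → (xs ++ B ∷ ys) ≡ [] ⊎ n ≤ 1 → n ≤ 1
fat⇒few-thin []      (inj₁ ())
fat⇒few-thin (_ ∷ _) (inj₁ ())
fat⇒few-thin _       (inj₂ n≤1) = n≤1

length-shrink : ∀ {A : Set} (xs : List A) {y ys} → length (xs ++ ys) ≤ length (xs ++ y ∷ ys)
length-shrink xs = NP.≤-trans (NP.n≤1+n _) (NP.≤-reflexive (≡.sym (length-extract xs)))

new-fat-ok : ∀ {j s} → 0ℚ Q.< s → 1 ≡ suc j → FatOK j [ s ]
new-fat-ok {s = s} pos e = e , ≡.subst (0ℚ Q.≤_) (≡.sym (level-single s)) (QP.<⇒≤ pos)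

new-thin-ok : ∀ {j s} → 0ℚ Q.< s → 1 ≢ suc j → ThinOK j [ s ]
new-thin-ok {s = s} pos ne =
  NP.≤-refl , NP.n≢0⇒n>0 (λ j≡0 → ne (≡.cong suc (≡.sym j≡0))) ,
  ≡.subst (0ℚ Q.<_) (≡.sym (level-single s)) pos

rule1-invariant : ∀ {j s p t} xs {B ys} → 1ℚ Q.< level B Q.+ s →
  Invariant j (st p (xs ++ B ∷ ys) t) → Invariant j (st ((B , [ s ]) ∷ p) (xs ++ ys) t)
rule1-invariant {j} xs {B} ov (invariant pok fok tok tov few) =
  let (B-full , _) , fok′ = All-extract xs fok
      length-ok = ≡.subst (λ n → 2 + j ≤ n + 1) (≡.sym B-full) (NP.≤-reflexive (NP.+-comm 1 (suc j)))
  in invariant ((length-ok , overfull-single ov) ∷ pok) fok′ tok tov (inj₂ (fat⇒few-thin xs few))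

rule2-invariant : ∀ {j s p f σ'} → 0ℚ Q.< s → AddNew (2 + j) s (st p f []) σ' →
  Invariant j (st p f []) → Invariant j σ'
rule2-invariant pos (newFat e)   (invariant pok fok _ _ _) =
  invariant pok (new-fat-ok pos e ∷ fok) [] [] (inj₂ z≤n)
rule2-invariant pos (newThin ne) (invariant pok fok _ _ _) =
  invariant pok fok (new-thin-ok pos ne ∷ []) ([] ∷ []) (inj₂ NP.≤-refl)

-- Rule (3), B stays thin: s joins B, which keeps overflowing with the other thin bins.
rule3-thin-invariant : ∀ {j s p f} xs {B ys} → 0ℚ Q.< s → length (s ∷ B) < suc j →
  Invariant j (st p f (xs ++ B ∷ ys)) → Invariant j (st p f (xs ++ (s ∷ B) ∷ ys))
rule3-thin-invariant xs {B} pos short (invariant pok fok tok tov few) =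
  let grows = level-∷ B (QP.<⇒≤ pos)
      (_ , _ , B-pos) , tok′ = All-extract xs tok
      B-overfull , tov′ = AllPairs-extract overfull-sym xs tov
      same-length = ≡.trans (length-extract xs) (≡.sym (length-extract xs))
  in invariant pok fok
       (All-insert xs (s≤s z≤n , s≤s⁻¹ short , QP.<-≤-trans B-pos grows) tok′)
       (AllPairs-insert overfull-sym xs (All.map (overfull-mono grows) B-overfull) tov′)
       (Sum.map₂ (≡.subst (_≤ 1) same-length) few)

rule3-pair-invariant : ∀ {j s p f} xs {B ys} us {B' vs} → 0ℚ Q.< s → length (s ∷ B) ≡ suc j →
  xs ++ ys ≡ us ++ B' ∷ vs →
  Invariant j (st p f (xs ++ B ∷ ys)) → Invariant j (st ((s ∷ B , B') ∷ p) f (us ++ vs))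
rule3-pair-invariant {j} xs {B} us {B'} pos full split (invariant pok fok tok tov few) =
  let _ , tok₁ = All-extract xs tok
      (B'-nonempty , _) , tok′ = All-extract us (≡.subst (All (ThinOK j)) split tok₁)
      B-overfull , tov₁ = AllPairs-extract overfull-sym xs tov
      BB' , _ = All-extract us (≡.subst (All (Overfull B)) split B-overfull)
      _ , tov′ = AllPairs-extract overfull-sym us (≡.subst (AllPairs Overfull) split tov₁)
      length-ok = ≡.subst (λ n → 2 + j ≤ n + length B') (≡.sym full)
                    (NP.≤-trans (NP.≤-reflexive (NP.+-comm 1 (suc j))) (NP.+-monoʳ-≤ (suc j) B'-nonempty))
      shrink = NP.≤-trans (NP.≤-trans (length-shrink us) (NP.≤-reflexive (≡.cong length (≡.sym split))))
                          (length-shrink xs)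
  in invariant ((length-ok , overfull-mono (level-∷ B (QP.<⇒≤ pos)) BB') ∷ pok) fok tok′ tov′
       (Sum.map₂ (NP.≤-trans shrink) few)

rule3-fat-invariant : ∀ {j s p f} xs {B ys} → 0ℚ Q.< s → length (s ∷ B) ≡ suc j →
  Invariant j (st p f (xs ++ B ∷ ys)) → Invariant j (st p ((s ∷ B) ∷ f) [])
rule3-fat-invariant xs {B} pos full (invariant pok fok tok _ _) =
  let (_ , _ , B-pos) , _ = All-extract xs tok
  in invariant pok ((full , QP.≤-trans (QP.<⇒≤ B-pos) (level-∷ B (QP.<⇒≤ pos))) ∷ fok) [] [] (inj₂ z≤n)

-- Rule (4): no fat bins and s fits into no thin bin, so s opens a new bin, which
-- overflows with every thin bin.  It cannot be fat: thin bins exist only when k > 2.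
rule4-invariant : ∀ {j s p t σ'} → 0ℚ Q.< s → t ≢ [] → All (λ C → 1ℚ Q.< level C Q.+ s) t →
  AddNew (2 + j) s (st p [] t) σ' → Invariant j (st p [] t) → Invariant j σ'
rule4-invariant {t = []}    _ t≢[] _ _ _ = contradiction ≡.refl t≢[]
rule4-invariant {t = _ ∷ _} _ _ _ (newFat e) (invariant _ _ ((C-nonempty , C-short , _) ∷ _) _ _) =
  contradiction (≡.sym (NP.suc-injective (≡.sym e))) (NP.<⇒≢ (NP.≤-trans C-nonempty C-short))
rule4-invariant pos _ fits (newThin ne) (invariant pok fok tok tov _) =
  invariant pok fok (new-thin-ok pos ne ∷ tok)
    (All.map (overfull-sym ∘ overfull-single) fits ∷ tov) (inj₁ ≡.refl)

rule5-invariant : ∀ {j s p} xs {B ys} us {B' vs} → 0ℚ Q.< s →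
  All (λ C → 1ℚ Q.< level C Q.+ s) (us ++ B' ∷ vs) →
  Invariant j (st p (xs ++ B ∷ ys) (us ++ B' ∷ vs)) →
  Invariant j (st ((s ∷ B , B') ∷ p) (xs ++ ys) (us ++ vs))
rule5-invariant {j} {s} xs {B} us {B'} pos fits (invariant pok fok tok tov few) =
  let (B-full , B-nonneg) , fok′ = All-extract xs fok
      _ , tok′ = All-extract us tok
      _ , tov′ = AllPairs-extract overfull-sym us tov
      s-overfull = overfull-sym (overfull-single (proj₁ (All-extract us fits)))
      s≤sB : level [ s ] Q.≤ level (s ∷ B)
      s≤sB = QP.+-monoʳ-≤ s B-nonneg
      length-ok = ≡.subst (λ n → 2 + j ≤ suc n + length B') (≡.sym B-full) (NP.m≤m+n (2 + j) _)
  in invariant ((length-ok , overfull-mono s≤sB s-overfull) ∷ pok) fok′ tok′ tov′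
       (inj₂ (NP.≤-trans (length-shrink us) (fat⇒few-thin xs few)))

step-invariant : ∀ {j s σ σ'} → Step (2 + j) s σ σ' → 0ℚ Q.< s → Invariant j σ → Invariant j σ'
step-invariant (step1 {xs = xs} ov) _                              = rule1-invariant xs ov
step-invariant (step2 _ new) pos                                   = rule2-invariant pos new
step-invariant (step3-thin {xs = xs} _ _ short) pos                = rule3-thin-invariant xs pos short
step-invariant (step3-pair {xs = xs} {us = us} _ _ full split) pos = rule3-pair-invariant xs us pos full split
step-invariant (step3-fat {xs = xs} _ _ full _) pos                = rule3-fat-invariant xs pos full
step-invariant (step4 t≢[] fits new) pos                           = rule4-invariant pos t≢[] fits new
step-invariant (step5 {xs = xs} {us = us} _ fits) pos              = rule5-invariant xs us pos fits

run-invariant : ∀ {j σ L σ'} → Run (2 + j) σ L σ' → All ValidSize L → Invariant j σ → Invariant j σ'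
run-invariant done            _                   inv = inv
run-invariant (next step run) ((pos , _) ∷ sizes) inv =
  run-invariant run sizes (step-invariant step pos inv)

initial-invariant : ∀ {j} → Invariant j initial
initial-invariant = invariant [] [] [] [] (inj₁ ≡.refl)

items-lower : ∀ {j p f t} → Invariant j (st p f t) →
              (2 + j) * length p + (suc j * length f + length t) ≤ items (st p f t)
items-lower {j} {p} {f} {t} inv = NP.+-mono-≤ paired-items (NP.+-mono-≤ fat-items thin-items)
  where
    paired-items : (2 + j) * length p ≤ ℕΣ.Σ⟨ ℕΣ.pairWeight (const 1) ⟩ p
    paired-items = ≡.subst (_≤ _) (ℕΣ-const (2 + j) p) (ℕΣ-mono (All.map proj₁ (paired-ok inv)))
    fat-items : suc j * length f ≤ ℕΣ.Σ⟨ length ⟩ f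
    fat-items = ≡.subst (_≤ _) (ℕΣ-const (suc j) f)
                  (ℕΣ-mono (All.map (NP.≤-reflexive ∘ ≡.sym ∘ proj₁) (fat-ok inv)))
    thin-items : length t ≤ ℕΣ.Σ⟨ length ⟩ t
    thin-items = ℕΣ-mono {f = const 1} (All.map proj₁ (thin-ok inv))

-- Among bins of positive level that pairwise overflow, the first ⌊n/2⌋ disjoint
-- pairs each have level > 1; a nonempty such list has level > ⌊n/2⌋.
overfull-half-≤ : ∀ Bs → All (λ C → 0ℚ Q.< level C) Bs → AllPairs Overfull Bs →
                  fromℕ ⌊ length Bs /2⌋ Q.≤ ℚΣ.Σ⟨ level ⟩ Bs
overfull-half-< : ∀ B Bs → All (λ C → 0ℚ Q.< level C) (B ∷ Bs) → AllPairs Overfull (B ∷ Bs) →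
                  fromℕ ⌊ length (B ∷ Bs) /2⌋ Q.< ℚΣ.Σ⟨ level ⟩ (B ∷ Bs)

overfull-half-≤ []       _   _  = QP.≤-refl
overfull-half-≤ (B ∷ Bs) pos ov = QP.<⇒≤ (overfull-half-< B Bs pos ov)

overfull-half-< B [] (B-pos ∷ []) _ = ≡.subst (0ℚ Q.<_) (≡.sym (QP.+-identityʳ (level B))) B-pos
overfull-half-< B (C ∷ Bs) (_ ∷ _ ∷ pos) ((overfull BC ∷ _) ∷ _ ∷ ov) = begin-strict
  1ℚ Q.+ fromℕ ⌊ length Bs /2⌋                  <⟨ QP.+-mono-<-≤ BC (overfull-half-≤ Bs pos ov) ⟩
  (level B Q.+ level C) Q.+ ℚΣ.Σ⟨ level ⟩ Bs    ≡⟨ QP.+-assoc (level B) (level C) _ ⟩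
  level B Q.+ (level C Q.+ ℚΣ.Σ⟨ level ⟩ Bs)    ∎
  where open QP.≤-Reasoning

size-lower : ∀ {j p B t} → Invariant j (st p [] (B ∷ t)) →
             fromℕ (length p + ⌊ length (B ∷ t) /2⌋) Q.< size (st p [] (B ∷ t))
size-lower {p = p} {B} {t} inv = begin-strict
  fromℕ (length p + ⌊ length (B ∷ t) /2⌋)            ≡⟨ fromℕ-+ (length p) _ ⟩
  fromℕ (length p) Q.+ fromℕ ⌊ length (B ∷ t) /2⌋    <⟨ QP.+-mono-≤-< paired-size thin-size ⟩
  Σp Q.+ ℚΣ.Σ⟨ level ⟩ (B ∷ t)                        ≡⟨ ≡.cong (Σp Q.+_) (≡.sym (QP.+-identityˡ _)) ⟩
  size (st p [] (B ∷ t))                              ∎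
  where
    open QP.≤-Reasoning
    Σp : ℚ
    Σp = ℚΣ.Σ⟨ ℚΣ.pairWeight id ⟩ p
    paired-size : fromℕ (length p) Q.≤ Σp
    paired-size = ≡.subst (Q._≤ Σp) (ℚΣ-one p)
                    (ℚΣ-mono (All.map (QP.<⇒≤ ∘ excess ∘ proj₂) (paired-ok inv)))
    thin-size : fromℕ ⌊ length (B ∷ t) /2⌋ Q.< ℚΣ.Σ⟨ level ⟩ (B ∷ t)
    thin-size = overfull-half-< B t (All.map (proj₂ ∘ proj₂) (thin-ok inv)) (thin-overfull inv)

-- Case #thin ≤ #fat, by counting items: k(2p + f + t) ≤ 2(kp + (k-1)f + t) ≤ 2km.
count-bound : ∀ j np nf nt m → nt ≤ nf →
              (2 + j) * np + (suc j * nf + nt) ≤ (2 + j) * m → 2 * np + nf + nt ≤ 2 * m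
count-bound j np nf nt m nt≤nf items≤ with NP.m≤n⇒∃[o]m+o≡n nt≤nf
... | d , ≡.refl = NP.*-cancelˡ-≤ (2 + j) (begin
  (2 + j) * (2 * np + (nt + d) + nt)             ≤⟨ NP.m≤m+n _ (j * d) ⟩
  (2 + j) * (2 * np + (nt + d) + nt) + j * d     ≡⟨ double-count j np nt d ⟩
  2 * ((2 + j) * np + (suc j * (nt + d) + nt))   ≤⟨ NP.*-monoʳ-≤ 2 items≤ ⟩
  2 * ((2 + j) * m)                              ≡⟨ swap-factors j m ⟩
  (2 + j) * (2 * m)                              ∎)
  where
    open NP.≤-Reasoning
    open +-*-Solver
    double-count : ∀ j np nt d → (2 + j) * (2 * np + (nt + d) + nt) + j * d ≡
                                 2 * ((2 + j) * np + (suc j * (nt + d) + nt))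
    double-count = solve 4 (λ j np nt d →
      (con 2 :+ j) :* (con 2 :* np :+ (nt :+ d) :+ nt) :+ j :* d :=
      con 2 :* ((con 2 :+ j) :* np :+ ((con 1 :+ j) :* (nt :+ d) :+ nt))) ≡.refl
    swap-factors : ∀ j m → 2 * ((2 + j) * m) ≡ (2 + j) * (2 * m)
    swap-factors = solve 2 (λ j m → con 2 :* ((con 2 :+ j) :* m) := (con 2 :+ j) :* (con 2 :* m)) ≡.refl

≤-double-half : ∀ n → n ≤ suc (⌊ n /2⌋ + ⌊ n /2⌋)
≤-double-half zero          = z≤n
≤-double-half (suc zero)    = s≤s z≤n
≤-double-half (suc (suc n)) =
  s≤s (s≤s (NP.≤-trans (≤-double-half n) (NP.≤-reflexive (≡.sym (NP.+-suc ⌊ n /2⌋ ⌊ n /2⌋)))))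

size-bound : ∀ np nt m → np + ⌊ nt /2⌋ < m → 2 * np + 0 + nt ≤ 2 * m
size-bound np nt m size< = begin
  2 * np + 0 + nt                              ≤⟨ NP.+-monoʳ-≤ (2 * np + 0) (≤-double-half nt) ⟩
  2 * np + 0 + suc (⌊ nt /2⌋ + ⌊ nt /2⌋)       <⟨ NP.n<1+n _ ⟩
  suc (2 * np + 0 + suc (⌊ nt /2⌋ + ⌊ nt /2⌋)) ≡⟨ regroup np ⌊ nt /2⌋ ⟩
  2 * suc (np + ⌊ nt /2⌋)                      ≤⟨ NP.*-monoʳ-≤ 2 size< ⟩
  2 * m                                        ∎
  where
    open NP.≤-Reasoning
    open +-*-Solver
    regroup : ∀ np h → suc (2 * np + 0 + suc (h + h)) ≡ 2 * suc (np + h)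
    regroup = solve 2 (λ np h → con 1 :+ (con 2 :* np :+ con 0 :+ (con 1 :+ (h :+ h))) :=
                                con 2 :* (con 1 :+ (np :+ h))) ≡.refl

-- The two counting arguments combined (if #thin > #fat there is no fat bin, since
-- a fat bin allows at most one thin bin): the invariant, ≤ k·m items and size ≤ m
-- force at most 2m bins.
tf-bound : ∀ {j σ m} → Invariant j σ → items σ ≤ (2 + j) * m → size σ Q.≤ fromℕ m →
           bins σ ≤ 2 * m
tf-bound {j} {st p f t} {m} inv items≤ _ with length t ≤? length f
... | yes t≤f =
  count-bound j (length p) (length f) (length t) m t≤f (NP.≤-trans (items-lower inv) items≤)
tf-bound {σ = st p [] []} _ _ _ | no t≰f = contradiction z≤n t≰f
tf-bound {σ = st p [] (B ∷ t)} {m} inv _ size≤ | no _ =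
  size-bound (length p) (length (B ∷ t)) m
    (fromℕ-cancel-< _ m (QP.<-≤-trans (size-lower inv) size≤))
tf-bound {σ = st p (B ∷ f) t} inv _ _ | no t≰f =
  contradiction (NP.≤-trans (fat⇒few-thin [] (few-thin inv)) (s≤s z≤n)) t≰f

packing-items : ∀ {k} P → All (λ B → length B ≤ k × level B Q.≤ 1ℚ) P →
                ℕΣ.Σ⟨ length ⟩ P ≤ k * length P
packing-items {k} P P-valid =
  ≡.subst (ℕΣ.Σ⟨ length ⟩ P ≤_) (ℕΣ-const k P) (ℕΣ-mono (All.map proj₁ P-valid))

packing-size : ∀ {k} P → All (λ B → length B ≤ k × level B Q.≤ 1ℚ) P →
               ℚΣ.Σ⟨ level ⟩ P Q.≤ fromℕ (length P)
packing-size P P-valid =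
  ≡.subst (ℚΣ.Σ⟨ level ⟩ P Q.≤_) (ℚΣ-one P) (ℚΣ-mono (All.map proj₂ P-valid))

mainTheorem12 : (k : ℕ) → 2 ≤ k → (L : List ℚ) → All ValidSize L →
    (σ : TFState) → Run k initial L σ →
    (P : List Bin) → ValidPacking k L P →
    bins σ ≤ 2 * length P
mainTheorem12 (suc (suc j)) (s≤s (s≤s z≤n)) L sizes σ run P (P↭L , P-valid) =
  tf-bound {m = length P} (run-invariant run sizes initial-invariant) items≤ size≤
  where
    items≤ : items σ ≤ (2 + j) * length P
    items≤ = ≡.subst (_≤ (2 + j) * length P) (≡.sym (ℕΣ.tf-weight (const 1) P run P↭L))
               (packing-items P P-valid)
    size≤ : size σ Q.≤ fromℕ (length P)
    size≤ = ≡.subst (Q._≤ fromℕ (length P)) (≡.sym (ℚΣ.tf-weight id P run P↭L))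
              (packing-size P P-valid)
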